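{- Let $v_1,\ldots,v_m$ be points on a circle taken in cyclic order (with $v_{m+1}=v_1$), and let $L:\{v_1,\ldots,v_m\}\to\{1,\ldots,n\}$ be a neighboring labelling. Then $$\deg([1,2],L)=\deg([2,3],L)=\cdots=\deg([n-1,n],L)=\deg([n,1],L).$$
   Context: Labels $1,\ldots,n$ are in cyclic order: $i$ and $i+1$ are neighbors, and $n$ and $1$ are neighbors. $L$ is a neighboring labelling if for every $i=1,\ldots,m$ either $L(v_i)=L(v_{i+1})$ or $L(v_i)$ and $L(v_{i+1})$ are neighbors. For labels $a,b$, $\deg([a,b],L):=p-q$, where $p$ is the number of indices $k\in\{1,\ldots,m\}$ with $L(v_k)=a$ and $L(v_{k+1})=b$, and $q$ is the number of indices $k$ with $L(v_k)=b$ and $L(v_{k+1})=a$. -}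

module Defs where

open import Data.Nat using (ℕ; zero; suc)
open import Data.Fin using (Fin; zero; suc; _≟_)
open import Data.Integer using (ℤ; _-_; +_)
open import Data.List using (List; length; filter)
open import Data.List.Base using (allFin)
open import Data.Product using (_×_)
open import Data.Sum using (_⊎_)
open import Relation.Binary.PropositionalEquality using (_≡_)
open import Relation.Nullary using (Dec; yes; no; ¬_)
open import Relation.Nullary.Decidable using (_×-dec_)

-- Cyclic successor on Fin k: i ↦ i+1, and the last element ↦ 0.
-- (Labels 1..n are represented by Fin n via 0..n-1; points v_1..v_m by Fin m.)
csuc : ∀ {k} → Fin k → Fin k
csuc {suc zero} zero = zero
csuc {suc (suc k)} zero = suc zero
csuc {suc (suc k)} (suc i) with csuc {suc k} i
... | zero = zero
... | suc j = suc (suc j)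

NeighborOrEqual : ∀ {n} → Fin n → Fin n → Set
NeighborOrEqual a b = (a ≡ b) ⊎ ((b ≡ csuc a) ⊎ (a ≡ csuc b))

Neighboring : ∀ {m n} → (Fin m → Fin n) → Set
Neighboring {m} L = ∀ (k : Fin m) → NeighborOrEqual (L k) (L (csuc k))

count : ∀ {m n} → (Fin m → Fin n) → Fin n → Fin n → ℕ
count {m} L a b = length (filter (λ k → (L k ≟ a) ×-dec (L (csuc k) ≟ b)) (allFin m))

deg : ∀ {m n} → Fin n → Fin n → (Fin m → Fin n) → ℤ
deg a b L = (+ count L a b) - (+ count L b a)

module Submission where

-- Read the labelling L as a closed walk
-- L(v₁) → L(v₂) → … → L(vₘ) → L(v₁) on the labels, and write count L u v for
-- the number of steps u → v.  The number of visits to a label a can be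
-- counted by the steps leaving a or by the steps entering a; since the walk
-- is closed these agree (a cyclic shift does not change a sum over Fin m).
-- For a neighbouring labelling the only steps out of a go to a, a+1 or a-1,
-- and for n ≥ 3 these are three distinct labels, so
--     count(a,a) + count(a,a+1) + count(a,a-1)
--       = count(a,a) + count(a+1,a) + count(a-1,a),
-- which rearranges to deg([a-1,a]) = deg([a,a+1]).  For n = 2 the same
-- argument (with the two labels 0, 1) gives count(0,1) = count(1,0).

open import Defs
open import Data.Nat using (ℕ; zero; suc; _+_; _*_)
open import Data.Nat.Properties
  using (+-0-commutativeMonoid; +-assoc; +-comm; +-identityʳ; *-comm; *-distribˡ-+; *-distribʳ-+;
         +-cancelˡ-≡; 1+n≢n; >⇒≢; m<n⇒m<1+n; n<1+n)
open import Data.Fin using (Fin; zero; suc; _≟_; fromℕ; inject₁; toℕ)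
open import Data.Fin.Properties using (suc-injective; toℕ-inject₁)
open import Data.Fin.Induction using (<-weakInduction)
open import Data.Fin.Relation.Unary.Top using (view; ‵fromℕ; ‵inj₁)
open import Data.Integer using (+_; _-_; _⊖_)
open import Data.Integer.Properties using (m-n≡m⊖n; +-cancelˡ-⊖)
open import Data.List using (length; filter; tabulate)
open import Data.Product using (_×_)
open import Data.Sum using (_⊎_; inj₁; inj₂)
open import Function using (_∘_; id)
open import Relation.Binary.PropositionalEquality
open import Relation.Nullary using (Dec; yes; no; ¬_; contradiction)
open import Relation.Nullary.Decidable using (_×-dec_)
open import Algebra.Properties.CommutativeMonoid.Sum +-0-commutativeMonoid
  using (sum; sum-cong-≗; ∑-distrib-+; sum-init-last)

open ≡-Reasoning

𝟙 : ∀ {p} {P : Set p} → Dec P → ℕ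
𝟙 (yes _) = 1
𝟙 (no _)  = 0

𝟙-yes : ∀ {p} {P : Set p} (d : Dec P) → P → 𝟙 d ≡ 1
𝟙-yes (yes _) _ = refl
𝟙-yes (no ¬p) p = contradiction p ¬p

𝟙-no : ∀ {p} {P : Set p} (d : Dec P) → ¬ P → 𝟙 d ≡ 0
𝟙-no (yes p) ¬p = contradiction p ¬p
𝟙-no (no _)  _  = refl

𝟙-× : ∀ {P Q : Set} (d : Dec P) (e : Dec Q) → 𝟙 (d ×-dec e) ≡ 𝟙 d * 𝟙 e
𝟙-× (yes _) (yes _) = refl
𝟙-× (yes _) (no _)  = refl
𝟙-× (no _)  _       = refl

𝟙-weight : ∀ {p} {P : Set p} (d : Dec P) {w : ℕ} → (P → w ≡ 1) → 𝟙 d * w ≡ 𝟙 d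
𝟙-weight (yes p) {w} w≡1 = trans (+-identityʳ w) (w≡1 p)
𝟙-weight (no _)      _   = refl

δ : ∀ {n} → Fin n → Fin n → ℕ
δ a z = 𝟙 (z ≟ a)

csuc-inject₁ : ∀ {k} (i : Fin k) → csuc {suc k} (inject₁ i) ≡ suc i
csuc-inject₁ {suc k} zero = refl
csuc-inject₁ {suc k} (suc i) with csuc {suc k} (inject₁ i) | csuc-inject₁ i
... | .(suc i) | refl = refl

csuc-fromℕ : ∀ k → csuc {suc k} (fromℕ k) ≡ zero
csuc-fromℕ zero = refl
csuc-fromℕ (suc k) with csuc {suc k} (fromℕ k) | csuc-fromℕ k
... | .zero | refl = refl

csuc-injective : ∀ {k} (x y : Fin k) → csuc x ≡ csuc y → x ≡ y
csuc-injective {suc k} x y eq with view x | view y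
... | ‵fromℕ | ‵fromℕ = refl
... | ‵fromℕ | ‵inj₁ {i = j} _
  with () ← trans (sym (csuc-fromℕ k)) (trans eq (csuc-inject₁ j))
... | ‵inj₁ {i = i} _ | ‵fromℕ
  with () ← trans (sym (csuc-inject₁ i)) (trans eq (csuc-fromℕ k))
... | ‵inj₁ {i = i} _ | ‵inj₁ {i = j} _ =
  cong inject₁ (suc-injective (trans (sym (csuc-inject₁ i)) (trans eq (csuc-inject₁ j))))

csuc-step : ∀ {k} (x : Fin (suc k)) → x ≡ fromℕ k ⊎ toℕ (csuc x) ≡ suc (toℕ x)
csuc-step x with view x
... | ‵fromℕ = inj₁ refl
... | ‵inj₁ {i = i} _ = inj₂ (trans (cong toℕ (csuc-inject₁ i)) (cong suc (sym (toℕ-inject₁ i))))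

csuc-top : ∀ {k} {x : Fin (suc k)} → x ≡ fromℕ k → csuc x ≡ zero
csuc-top {k} refl = csuc-fromℕ k

csuc-≢ : ∀ {k} (x : Fin (suc (suc k))) → csuc x ≢ x
csuc-≢ x eq with csuc-step x
... | inj₁ top with () ← trans (trans (sym (csuc-top top)) eq) top
... | inj₂ up  = 1+n≢n (trans (sym up) (cong toℕ eq))

csuc²-≢ : ∀ {k} (x : Fin (suc (suc (suc k)))) → csuc (csuc x) ≢ x
csuc²-≢ x eq with csuc-step x | csuc-step (csuc x)
... | inj₁ top | _ with () ← trans (trans (sym (cong csuc (csuc-top top))) eq) top
... | inj₂ _ | inj₁ top with () ← trans (sym (cong csuc (trans (sym eq) (csuc-top top)))) top
... | inj₂ up | inj₂ up′ =
  >⇒≢ (m<n⇒m<1+n (n<1+n _)) (trans (sym (trans up′ (cong suc up))) (cong toℕ eq))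

csuc-induction : ∀ {k} (P : Fin (suc k) → Set) → P zero → (∀ i → P i → P (csuc i)) → ∀ i → P i
csuc-induction P P₀ preserved =
  <-weakInduction P P₀ (λ i Pi → subst P (csuc-inject₁ i) (preserved (inject₁ i) Pi))

sum-rotate : ∀ {m} (f : Fin m → ℕ) → sum (f ∘ csuc) ≡ sum f
sum-rotate {zero}  f = refl
sum-rotate {suc m} f = begin
  sum (f ∘ csuc)                                ≡⟨ sum-init-last (f ∘ csuc) ⟩
  sum (f ∘ csuc ∘ inject₁) + f (csuc (fromℕ m)) ≡⟨ cong₂ _+_ (sum-cong-≗ (cong f ∘ csuc-inject₁))
                                                             (cong f (csuc-fromℕ m)) ⟩
  sum (f ∘ suc) + f zero                        ≡⟨ +-comm _ (f zero) ⟩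
  sum f                                         ∎

length-filter-tabulate : ∀ {m} {A : Set} {P : A → Set} (P? : ∀ x → Dec (P x)) (g : Fin m → A) →
  length (filter P? (tabulate g)) ≡ sum (λ k → 𝟙 (P? (g k)))
length-filter-tabulate {zero}  P? g = refl
length-filter-tabulate {suc m} P? g with P? (g zero)
... | yes _ = cong suc (length-filter-tabulate P? (g ∘ suc))
... | no _  = length-filter-tabulate P? (g ∘ suc)

flow : ∀ {m n} → (Fin m → Fin n) → (Fin n → ℕ) → (Fin n → ℕ) → ℕ
flow L f g = sum (λ k → f (L k) * g (L (csuc k)))

count≡flow : ∀ {m n} (L : Fin m → Fin n) (u v : Fin n) → count L u v ≡ flow L (δ u) (δ v)
count≡flow L u v = begin
  count L u v                                              ≡⟨ length-filter-tabulate step? id ⟩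
  sum (λ k → 𝟙 ((L k ≟ u) ×-dec (L (csuc k) ≟ v)))         ≡⟨ sum-cong-≗ (λ k → 𝟙-× (L k ≟ u) (L (csuc k) ≟ v)) ⟩
  flow L (δ u) (δ v)                                       ∎
  where
  step? : ∀ k → Dec (L k ≡ u × L (csuc k) ≡ v)
  step? k = (L k ≟ u) ×-dec (L (csuc k) ≟ v)

flow-+ʳ : ∀ {m n} (L : Fin m → Fin n) (f g h : Fin n → ℕ) →
  flow L f (λ z → g z + h z) ≡ flow L f g + flow L f h
flow-+ʳ L f g h = trans (sum-cong-≗ (λ k → *-distribˡ-+ (f (L k)) (g (L (csuc k))) (h (L (csuc k)))))
  (∑-distrib-+ (λ k → f (L k) * g (L (csuc k))) (λ k → f (L k) * h (L (csuc k))))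

flow-+ˡ : ∀ {m n} (L : Fin m → Fin n) (f g h : Fin n → ℕ) →
  flow L (λ z → f z + g z) h ≡ flow L f h + flow L g h
flow-+ˡ L f g h = trans (sum-cong-≗ (λ k → *-distribʳ-+ (h (L (csuc k))) (f (L k)) (g (L k))))
  (∑-distrib-+ (λ k → f (L k) * h (L (csuc k))) (λ k → g (L k) * h (L (csuc k))))

-- Conservation at a label a: if the weight w equals 1 on every label the
-- walk can move to from a, and on every label it can arrive at a from, then
-- the w-weighted steps out of a and into a both count the visits to a.
conservation : ∀ {m n} (L : Fin m → Fin n) (a : Fin n) (w : Fin n → ℕ) →
  (∀ k → L k ≡ a → w (L (csuc k)) ≡ 1) → (∀ k → L (csuc k) ≡ a → w (L k) ≡ 1) →
  flow L (δ a) w ≡ flow L w (δ a)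
conservation L a w out into = begin
  flow L (δ a) w                  ≡⟨ sum-cong-≗ (λ k → 𝟙-weight (L k ≟ a) (out k)) ⟩
  sum (λ k → δ a (L k))           ≡⟨ sym (sum-rotate (δ a ∘ L)) ⟩
  sum (λ k → δ a (L (csuc k)))    ≡⟨ sum-cong-≗ (λ k → sym (weight-left k)) ⟩
  flow L w (δ a)                  ∎
  where
  weight-left : ∀ k → w (L k) * δ a (L (csuc k)) ≡ δ a (L (csuc k))
  weight-left k = trans (*-comm (w (L k)) _) (𝟙-weight (L (csuc k) ≟ a) (into k))

flow-out-δ : ∀ {m n} (L : Fin m → Fin n) (a u v : Fin n) →
  flow L (δ a) (λ z → δ u z + δ v z) ≡ count L a u + count L a v
flow-out-δ L a u v =
  trans (flow-+ʳ L (δ a) (δ u) (δ v)) (sym (cong₂ _+_ (count≡flow L a u) (count≡flow L a v)))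

flow-in-δ : ∀ {m n} (L : Fin m → Fin n) (a u v : Fin n) →
  flow L (λ z → δ u z + δ v z) (δ a) ≡ count L u a + count L v a
flow-in-δ L a u v =
  trans (flow-+ˡ L (δ u) (δ v) (δ a)) (sym (cong₂ _+_ (count≡flow L u a) (count≡flow L v a)))

two-label-balance : ∀ {m} (L : Fin m → Fin 2) → count L zero (suc zero) ≡ count L (suc zero) zero
two-label-balance L = +-cancelˡ-≡ (count L zero zero) _ _ (begin
  count L zero zero + count L zero (suc zero) ≡⟨ flow-out-δ L zero zero (suc zero) ⟨
  flow L (δ zero) w                           ≡⟨ conservation L zero w (λ k _ → total (L (csuc k)))
                                                                       (λ k _ → total (L k)) ⟩
  flow L w (δ zero)                           ≡⟨ flow-in-δ L zero zero (suc zero) ⟩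
  count L zero zero + count L (suc zero) zero ∎)
  where
  w : Fin 2 → ℕ
  w z = δ zero z + δ (suc zero) z
  total : ∀ z → w z ≡ 1
  total zero       = refl
  total (suc zero) = refl

-- With n ≥ 3 labels, a neighbouring labelling enters a = c+1 only from
-- c, a, a+1 and leaves it only to these labels, which are distinct; so the
-- steps between a and its two neighbours balance.
local-balance : ∀ {m k} (L : Fin m → Fin (suc (suc (suc k)))) → Neighboring L → ∀ c →
  let a = csuc c ; b = csuc a in count L a b + count L a c ≡ count L b a + count L c a
local-balance {k = k} L N c = +-cancelˡ-≡ (count L a a) _ _ (begin
  count L a a + (count L a b + count L a c)   ≡⟨ +-assoc (count L a a) _ _ ⟨
  count L a a + count L a b + count L a c     ≡⟨ cong₂ _+_ (sym (flow-out-δ L a a b)) (count≡flow L a c) ⟩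
  flow L (δ a) (λ z → δ a z + δ b z) + flow L (δ a) (δ c)
                                              ≡⟨ flow-+ʳ L (δ a) (λ z → δ a z + δ b z) (δ c) ⟨
  flow L (δ a) w                              ≡⟨ conservation L a w (λ k → one-of-three ∘ leaving k)
                                                                    (λ k → one-of-three ∘ entering k) ⟩
  flow L w (δ a)                              ≡⟨ flow-+ˡ L (λ z → δ a z + δ b z) (δ c) (δ a) ⟩
  flow L (λ z → δ a z + δ b z) (δ a) + flow L (δ c) (δ a)
                                              ≡⟨ cong₂ _+_ (flow-in-δ L a a b) (sym (count≡flow L c a)) ⟩
  count L a a + count L b a + count L c a     ≡⟨ +-assoc (count L a a) _ _ ⟩
  count L a a + (count L b a + count L c a)   ∎)
  where
  a b : Fin (suc (suc (suc k)))
  a = csuc c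
  b = csuc a
  w : Fin (suc (suc (suc k))) → ℕ
  w z = δ a z + δ b z + δ c z
  a≢c : a ≢ c
  a≢c = csuc-≢ c
  b≢a : b ≢ a
  b≢a = csuc-≢ a
  b≢c : b ≢ c
  b≢c = csuc²-≢ c
  one-of-three : ∀ {z} → z ≡ a ⊎ z ≡ b ⊎ z ≡ c → w z ≡ 1
  one-of-three (inj₁ refl) =
    cong₂ _+_ (cong₂ _+_ (𝟙-yes (a ≟ a) refl) (𝟙-no (a ≟ b) (b≢a ∘ sym))) (𝟙-no (a ≟ c) a≢c)
  one-of-three (inj₂ (inj₁ refl)) =
    cong₂ _+_ (cong₂ _+_ (𝟙-no (b ≟ a) b≢a) (𝟙-yes (b ≟ b) refl)) (𝟙-no (b ≟ c) b≢c)
  one-of-three (inj₂ (inj₂ refl)) =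
    cong₂ _+_ (cong₂ _+_ (𝟙-no (c ≟ a) (a≢c ∘ sym)) (𝟙-no (c ≟ b) (b≢c ∘ sym))) (𝟙-yes (c ≟ c) refl)
  leaving : ∀ k → L k ≡ a → let y = L (csuc k) in y ≡ a ⊎ y ≡ b ⊎ y ≡ c
  leaving k e with N k
  ... | inj₁ same        = inj₁ (trans (sym same) e)
  ... | inj₂ (inj₁ up)   = inj₂ (inj₁ (trans up (cong csuc e)))
  ... | inj₂ (inj₂ down) = inj₂ (inj₂ (csuc-injective _ c (trans (sym down) e)))
  entering : ∀ k → L (csuc k) ≡ a → let x = L k in x ≡ a ⊎ x ≡ b ⊎ x ≡ c
  entering k e with N k
  ... | inj₁ same        = inj₁ (trans same e)
  ... | inj₂ (inj₁ up)   = inj₂ (inj₂ (csuc-injective _ c (trans (sym up) e)))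
  ... | inj₂ (inj₂ down) = inj₂ (inj₁ (trans down (cong csuc e)))

diff-balance : ∀ p q r s → p + q ≡ r + s → + s - + q ≡ + p - + r
diff-balance p q r s eq = begin
  + s - + q           ≡⟨ m-n≡m⊖n s q ⟩
  s ⊖ q               ≡⟨ +-cancelˡ-⊖ p s q ⟨
  (p + s) ⊖ (p + q)   ≡⟨ cong ((p + s) ⊖_) eq ⟩
  (p + s) ⊖ (r + s)   ≡⟨ cong₂ _⊖_ (+-comm p s) (+-comm r s) ⟩
  (s + p) ⊖ (s + r)   ≡⟨ +-cancelˡ-⊖ s p r ⟩
  p ⊖ r               ≡⟨ m-n≡m⊖n p r ⟨
  + p - + r           ∎

consecutive-deg : ∀ {m k} (L : Fin m → Fin (suc (suc k))) → Neighboring L →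
  ∀ c → deg c (csuc c) L ≡ deg (csuc c) (csuc (csuc c)) L
consecutive-deg {k = zero}  L N zero       rewrite two-label-balance L = refl
consecutive-deg {k = zero}  L N (suc zero) rewrite two-label-balance L = refl
consecutive-deg {k = suc k} L N c =
  diff-balance (count L a b) (count L a c) (count L b a) (count L c a) (local-balance L N c)
  where
  a b : Fin (suc (suc (suc k)))
  a = csuc c
  b = csuc a

lemma2p1 : ∀ (m n : ℕ) (L : Fin m → Fin n) → Neighboring L →
    ∀ (i j : Fin n) → deg i (csuc i) L ≡ deg j (csuc j) L
lemma2p1 m zero          L N () j
lemma2p1 m (suc zero)    L N zero zero = refl
lemma2p1 m (suc (suc k)) L N i j = trans (deg≡deg₀ i) (sym (deg≡deg₀ j))
  where
  deg≡deg₀ : ∀ i → deg i (csuc i) L ≡ deg zero (csuc zero) L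
  deg≡deg₀ = csuc-induction (λ i → deg i (csuc i) L ≡ deg zero (csuc zero) L) refl
    (λ i eq → trans (sym (consecutive-deg L N i)) eq)
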